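{- Let $D,\ell\ge1$ be integers, $\Gamma$ a finite alphabet, and let $H:\Gamma^2\to\{0,1\}$ be distributed as a $(D,\ell)$-iterated pairwise independent function. Then for every $ab\in\Gamma^2$, $\frac{1}{2D}\le\Pr_H[H(ab)=0]\le\frac1D$. Furthermore, for every $S\subseteq\Gamma^2$ with $|S|=\ell D$, $\Pr_H[\forall ab\in S,\ H(ab)\ne0]\le 2^{ -\ell}$.
   Context: A family of functions $U\to V$ is pairwise independent if for all $u\ne u'$ and $v,v'$, $\Pr_h[h(u)=v\wedge h(u')=v']=1/|V|^2$ for $h$ uniform in the family. $H$ is a $(D,\ell)$-iterated pairwise independent function if it is obtained by selecting independently and uniformly at random $h_1,\dots,h_\ell:\Gamma^2\to\{0,\dots,\ell D-1\}$ from a pairwise independent family and setting, for each $ab\in\Gamma^2$, $H(ab)=0$ if $\prod_{i=1}^\ell h_i(ab)=0$ and $H(ab)=1$ otherwise. -}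

module Defs where

import Level

open import Data.Nat using (ℕ; zero; suc; _*_; _≟_)
open import Data.Fin using (Fin; toℕ)
open import Data.Product using (_×_)
open import Data.List using (List; []; _∷_; map; concatMap; allFin; filter; length)
open import Data.Nat.ListAction using (product)
import Data.Vec as V
open import Relation.Nullary using (yes; no)
open import Data.Vec using (Vec; toList) renaming ([] to []ᵥ; _∷_ to _∷ᵥ_)
open import Relation.Nullary using (Dec; ¬_)
open import Relation.Nullary.Decidable using (_×-dec_)
open import Relation.Unary using (Pred; Decidable)
open import Relation.Binary.PropositionalEquality using (_≡_)
open import Data.Fin using () renaming (_≟_ to _≟ᶠ_)

Γ² : ℕ → Set
Γ² n = Fin n × Fin n

-- A finite family of functions U → Fin m, indexed by Fin k; "h uniform in
-- the family" means the index is uniform in Fin k.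
Family : ℕ → Set → ℕ → Set
Family k U m = Fin k → U → Fin m

-- Pairwise independence: for all u ≠ u' and v, v',
--   #{ i | h_i u = v ∧ h_i u' = v' } / k = 1 / m²,
-- written cross-multiplied.
PairwiseIndependent : ∀ {k m} {U : Set} → Family k U m → Set
PairwiseIndependent {k} {m} {U} h =
  ∀ (u u' : U) → ¬ (u ≡ u') → ∀ (v v' : Fin m) →
    length (filter (λ i → (h i u ≟ᶠ v) ×-dec (h i u' ≟ᶠ v')) (allFin k)) * (m * m) ≡ k

allVecs : ∀ {A : Set} → List A → (ℓ : ℕ) → List (Vec A ℓ)
allVecs xs zero = []ᵥ ∷ []
allVecs xs (suc ℓ) = concatMap (λ x → map (x ∷ᵥ_) (allVecs xs ℓ)) xs

-- Sample space of the iterated construction: independent uniform choices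
-- (h_1,…,h_ℓ) from the family, i.e. uniform vectors in (Fin k)^ℓ.
Ω : (k ℓ : ℕ) → List (Vec (Fin k) ℓ)
Ω k ℓ = allVecs (allFin k) ℓ

iteratedH : ∀ {k ℓ D} {U : Set} → Family k U (ℓ * D) → Vec (Fin k) ℓ → U → ℕ
iteratedH h c ab = zeroOrOne (product (toList (V.map (λ i → toℕ (h i ab)) c)))
  where
  zeroOrOne : ℕ → ℕ
  zeroOrOne zero = 0
  zeroOrOne (suc _) = 1

count : ∀ {A : Set} {P : Pred A Level.zero} → Decidable P → List A → ℕ
count P? xs = length (filter P? xs)

module Submission where

-- Let z = #{i | h_i(ab) = 0}. Pairwise independence makes every value of h_i(ab) equally likely,
-- so z·ℓD = k and H(ab) ≠ 0 exactly when all ℓ coordinates avoid zero, an event of probability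
-- (1 − 1/ℓD)^ℓ. The Bernoulli-type bounds 1 − 1/D ≤ (1 − 1/ℓD)^ℓ ≤ D/(D + 1) then put
-- Pr[H(ab) = 0] between 1/(2D) and 1/D. For |S| = ℓD, the number X of zeros of one h_i on S has
-- E[X] = 1 and, by pairwise independence, E[X²] ≤ 2; as 4·[X = 0] ≤ (X − 2)², h_i avoids zero on
-- all of S with probability at most 1/2, and the ℓ independent coordinates give 2^(−ℓ).

open import Data.Bool using (if_then_else_)
open import Data.Fin as Fin using (Fin; toℕ) renaming (_≟_ to _≟ᶠ_)
open import Data.Fin.Properties using (toℕ-injective; nonZeroIndex)
open import Data.List using (List; []; _∷_; _++_; length; map; concatMap; allFin)
open import Data.List.Membership.Propositional using (_∈_)
open import Data.List.Membership.Propositional.Properties using (∈-allFin)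
open import Data.List.Properties using (length-tabulate)
open import Data.List.Relation.Unary.All as All using (All; all?)
open import Data.List.Relation.Unary.All.Properties using (map⁺; map⁻)
open import Data.List.Relation.Unary.AllPairs using (_∷_)
open import Data.List.Relation.Unary.Any using (here; there)
open import Data.List.Relation.Unary.Unique.Propositional using (Unique)
open import Data.List.Relation.Unary.Unique.Propositional.Properties using (allFin⁺)
open import Data.Nat using (ℕ; zero; suc; _+_; _*_; _^_; _≤_; _≟_; NonZero; z≤n; s≤s)
open import Data.Nat.ListAction using (product)
open import Data.Nat.Properties
open import Data.Nat.Tactic.RingSolver using (solve)
open import Data.Product using (_×_; _,_; proj₂; ∃-syntax)
open import Data.Product.Properties using (≡-dec)
open import Data.Sum using ([_,_]′)
open import Data.Unit using (⊤; tt)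
open import Data.Vec as Vec using (Vec; toList)
open import Data.Vec.Properties using (toList-map)
open import Defs
open import Function using (_∘_)
open import Function.Bundles using (_⇔_; mk⇔; Equivalence)
open import Level using (0ℓ)
open import Relation.Binary.Definitions using (DecidableEquality)
open import Relation.Binary.PropositionalEquality
  using (_≡_; _≢_; refl; sym; trans; cong; cong₂; subst; module ≡-Reasoning)
open import Relation.Nullary using (Dec; yes; no; does; ¬_; contradiction)
open import Relation.Nullary.Decidable using (¬?; _×-dec_)
open import Relation.Unary using (Pred; Decidable)

open import Algebra.Properties.CommutativeSemigroup *-commutativeSemigroup using (x∙yz≈y∙xz; xy∙z≈y∙xz)
open import Algebra.Properties.CommutativeSemigroup +-commutativeSemigroup
  using () renaming (interchange to +-interchange)
open Equivalence using (to; from)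

private
  variable
    A B : Set

𝟙 : ∀ {a} {P : Set a} → Dec P → ℕ
𝟙 p = if does p then 1 else 0

module _ {a b} {P : Set a} {Q : Set b} where

  𝟙-cong : (P → Q) → (Q → P) → (p : Dec P) (q : Dec Q) → 𝟙 p ≡ 𝟙 q
  𝟙-cong f g (yes _) (yes _) = refl
  𝟙-cong f g (yes p) (no ¬q) = contradiction (f p) ¬q
  𝟙-cong f g (no ¬p) (yes q) = contradiction (g q) ¬p
  𝟙-cong f g (no _) (no _) = refl

  𝟙-×-dec : (p : Dec P) (q : Dec Q) → 𝟙 (p ×-dec q) ≡ 𝟙 p * 𝟙 q
  𝟙-×-dec (yes _) (yes _) = refl
  𝟙-×-dec (yes _) (no _) = refl
  𝟙-×-dec (no _) _ = refl

𝟙-idem : ∀ {a} {P : Set a} (p : Dec P) → 𝟙 p * 𝟙 p ≡ 𝟙 p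
𝟙-idem (yes _) = refl
𝟙-idem (no _) = refl

∑ : List A → (A → ℕ) → ℕ
∑ [] f = 0
∑ (x ∷ xs) f = f x + ∑ xs f

infix 5 ∑
syntax ∑ xs (λ x → e) = ∑[ x ∈ xs ] e

module _ {f g : A → ℕ} where

  ∑-cong : (∀ x → f x ≡ g x) → ∀ xs → ∑ xs f ≡ ∑ xs g
  ∑-cong f≗g [] = refl
  ∑-cong f≗g (x ∷ xs) = cong₂ _+_ (f≗g x) (∑-cong f≗g xs)

  ∑-mono-≤ : (∀ x → f x ≤ g x) → ∀ xs → ∑ xs f ≤ ∑ xs g
  ∑-mono-≤ f≤g [] = z≤n
  ∑-mono-≤ f≤g (x ∷ xs) = +-mono-≤ (f≤g x) (∑-mono-≤ f≤g xs)

  ∑-distrib-+ : ∀ xs → ∑[ x ∈ xs ] (f x + g x) ≡ ∑ xs f + ∑ xs g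
  ∑-distrib-+ [] = refl
  ∑-distrib-+ (x ∷ xs) = trans (cong (f x + g x +_) (∑-distrib-+ xs)) (+-interchange (f x) (g x) _ _)

∑-zero : {f : A → ℕ} {xs : List A} → All (λ x → f x ≡ 0) xs → ∑ xs f ≡ 0
∑-zero All.[] = refl
∑-zero (f≡0 All.∷ fs≡0) = cong₂ _+_ f≡0 (∑-zero fs≡0)

∑-const : ∀ (xs : List A) c → ∑[ x ∈ xs ] c ≡ length xs * c
∑-const [] c = refl
∑-const (x ∷ xs) c = cong (c +_) (∑-const xs c)

∑-*ˡ : ∀ c (f : A → ℕ) xs → ∑[ x ∈ xs ] c * f x ≡ c * ∑ xs f
∑-*ˡ c f [] = sym (*-zeroʳ c)
∑-*ˡ c f (x ∷ xs) = trans (cong (c * f x +_) (∑-*ˡ c f xs)) (sym (*-distribˡ-+ c (f x) _))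

∑-*ʳ : ∀ c (f : A → ℕ) xs → ∑[ x ∈ xs ] f x * c ≡ ∑ xs f * c
∑-*ʳ c f xs = begin
  ∑[ x ∈ xs ] f x * c  ≡⟨ ∑-cong (λ x → *-comm (f x) c) xs ⟩
  ∑[ x ∈ xs ] c * f x  ≡⟨ ∑-*ˡ c f xs ⟩
  c * ∑ xs f           ≡⟨ *-comm c _ ⟩
  ∑ xs f * c           ∎
  where open ≡-Reasoning

∑-++ : ∀ (f : A → ℕ) xs ys → ∑ (xs ++ ys) f ≡ ∑ xs f + ∑ ys f
∑-++ f [] ys = refl
∑-++ f (x ∷ xs) ys = trans (cong (f x +_) (∑-++ f xs ys)) (sym (+-assoc (f x) _ _))

∑-map : ∀ (f : B → ℕ) (g : A → B) xs → ∑ (map g xs) f ≡ ∑[ x ∈ xs ] f (g x)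
∑-map f g [] = refl
∑-map f g (x ∷ xs) = cong (f (g x) +_) (∑-map f g xs)

∑-concatMap : ∀ (f : B → ℕ) (g : A → List B) xs → ∑ (concatMap g xs) f ≡ ∑[ x ∈ xs ] ∑ (g x) f
∑-concatMap f g [] = refl
∑-concatMap f g (x ∷ xs) = trans (∑-++ f (g x) (concatMap g xs)) (cong (∑ (g x) f +_) (∑-concatMap f g xs))

∑-comm : ∀ (f : A → B → ℕ) xs ys → ∑[ x ∈ xs ] ∑[ y ∈ ys ] f x y ≡ ∑[ y ∈ ys ] ∑[ x ∈ xs ] f x y
∑-comm f [] ys = sym (trans (∑-const ys 0) (*-zeroʳ (length ys)))
∑-comm f (x ∷ xs) ys = trans (cong (∑ ys (f x) +_) (∑-comm f xs ys)) (sym (∑-distrib-+ ys))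

count≡∑𝟙 : ∀ {P : Pred A 0ℓ} (P? : Decidable P) xs → count P? xs ≡ ∑[ x ∈ xs ] 𝟙 (P? x)
count≡∑𝟙 P? [] = refl
count≡∑𝟙 P? (x ∷ xs) with P? x
... | yes _ = cong suc (count≡∑𝟙 P? xs)
... | no _ = count≡∑𝟙 P? xs

count-universal : ∀ {P : Pred A 0ℓ} (P? : Decidable P) → (∀ x → P x) → ∀ xs → count P? xs ≡ length xs
count-universal P? p [] = refl
count-universal P? p (x ∷ xs) with P? x
... | yes _ = cong suc (count-universal P? p xs)
... | no ¬p = contradiction (p x) ¬p

count-none : ∀ {P : Pred A 0ℓ} (P? : Decidable P) {xs} → All (¬_ ∘ P) xs → count P? xs ≡ 0
count-none P? All.[] = refl
count-none P? {x ∷ _} (¬p All.∷ ¬ps) with P? x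
... | yes p = contradiction p ¬p
... | no _ = count-none P? ¬ps

count-cong : ∀ {P Q : Pred A 0ℓ} (P? : Decidable P) (Q? : Decidable Q) →
  (∀ x → P x ⇔ Q x) → ∀ xs → count P? xs ≡ count Q? xs
count-cong P? Q? P⇔Q [] = refl
count-cong P? Q? P⇔Q (x ∷ xs) with P? x | Q? x
... | yes _ | yes _ = cong suc (count-cong P? Q? P⇔Q xs)
... | yes p | no ¬q = contradiction (to (P⇔Q x) p) ¬q
... | no ¬p | yes q = contradiction (from (P⇔Q x) q) ¬p
... | no _ | no _ = count-cong P? Q? P⇔Q xs

count-complement : ∀ {P Q : Pred A 0ℓ} (P? : Decidable P) (Q? : Decidable Q) →
  (∀ x → (¬ P x) ⇔ Q x) → ∀ xs → count P? xs + count Q? xs ≡ length xs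
count-complement P? Q? ¬P⇔Q [] = refl
count-complement P? Q? ¬P⇔Q (x ∷ xs) with P? x | Q? x
... | yes p | yes q = contradiction p (from (¬P⇔Q x) q)
... | yes _ | no _ = cong suc (count-complement P? Q? ¬P⇔Q xs)
... | no _ | yes _ = trans (+-suc _ _) (cong suc (count-complement P? Q? ¬P⇔Q xs))
... | no ¬p | no ¬q = contradiction (to (¬P⇔Q x) ¬p) ¬q

module _ (_≟ₐ_ : DecidableEquality A) where

  ∑-𝟙≟-∉ : ∀ {y xs} → All (y ≢_) xs → ∑[ x ∈ xs ] 𝟙 (y ≟ₐ x) ≡ 0
  ∑-𝟙≟-∉ {y} = ∑-zero ∘ All.map λ {x} y≢x → 𝟙-cong y≢x (λ ()) (y ≟ₐ x) (no λ ())

  ∑-𝟙≟-unique≤1 : ∀ y {xs} → Unique xs → ∑[ x ∈ xs ] 𝟙 (y ≟ₐ x) ≤ 1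
  ∑-𝟙≟-unique≤1 y {[]} _ = z≤n
  ∑-𝟙≟-unique≤1 y {x ∷ xs} (x∉xs ∷ xs!) with y ≟ₐ x
  ... | yes refl = ≤-reflexive (cong suc (∑-𝟙≟-∉ x∉xs))
  ... | no _ = ∑-𝟙≟-unique≤1 y xs!

  ∑-𝟙≟-unique∈ : ∀ {y xs} → Unique xs → y ∈ xs → ∑[ x ∈ xs ] 𝟙 (y ≟ₐ x) ≡ 1
  ∑-𝟙≟-unique∈ {y} {x ∷ xs} (x∉xs ∷ xs!) y∈ with y ≟ₐ x | y∈
  ... | yes refl | _ = cong suc (∑-𝟙≟-∉ x∉xs)
  ... | no y≢x | here y≡x = contradiction y≡x y≢x
  ... | no _ | there y∈xs = ∑-𝟙≟-unique∈ xs! y∈xs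

∑-𝟙≟-allFin : ∀ {n} (y : Fin n) → ∑[ x ∈ allFin n ] 𝟙 (y ≟ᶠ x) ≡ 1
∑-𝟙≟-allFin {n} y = ∑-𝟙≟-unique∈ _≟ᶠ_ (allFin⁺ n) (∈-allFin y)

length-allFin : ∀ n → length (allFin n) ≡ n
length-allFin n = length-tabulate (λ i → i)

All-swap : ∀ {R : A → B → Set} {xs ys} → All (λ x → All (R x) ys) xs → All (λ y → All (λ x → R x y) xs) ys
All-swap xs→ys = All.tabulate λ y∈ → All.tabulate λ x∈ → All.lookup (All.lookup xs→ys x∈) y∈

module _ {P : Pred A 0ℓ} (P? : Decidable P) where

  ∑-𝟙-all-allVecs : ∀ xs ℓ →
    ∑[ c ∈ allVecs xs ℓ ] 𝟙 (all? P? (toList c)) ≡ (∑[ x ∈ xs ] 𝟙 (P? x)) ^ ℓ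
  ∑-𝟙-all-allVecs xs zero = refl
  ∑-𝟙-all-allVecs xs (suc ℓ) = begin
    ∑ (concatMap (λ x → map (x Vec.∷_) cs) xs) (λ c → 𝟙 (all? P? (toList c)))
      ≡⟨ ∑-concatMap _ (λ x → map (x Vec.∷_) cs) xs ⟩
    ∑[ x ∈ xs ] ∑ (map (x Vec.∷_) cs) (λ c → 𝟙 (all? P? (toList c)))
      ≡⟨ ∑-cong (λ x → ∑-map _ (x Vec.∷_) cs) xs ⟩
    ∑[ x ∈ xs ] (∑[ c ∈ cs ] 𝟙 (P? x ×-dec all? P? (toList c)))
      ≡⟨ ∑-cong (λ x → ∑-cong (λ c → 𝟙-×-dec (P? x) (all? P? (toList c))) cs) xs ⟩
    ∑[ x ∈ xs ] (∑[ c ∈ cs ] 𝟙 (P? x) * 𝟙 (all? P? (toList c)))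
      ≡⟨ ∑-cong (λ x → ∑-*ˡ (𝟙 (P? x)) _ cs) xs ⟩
    ∑[ x ∈ xs ] 𝟙 (P? x) * (∑[ c ∈ cs ] 𝟙 (all? P? (toList c)))
      ≡⟨ ∑-*ʳ _ (λ x → 𝟙 (P? x)) xs ⟩
    (∑[ x ∈ xs ] 𝟙 (P? x)) * (∑[ c ∈ cs ] 𝟙 (all? P? (toList c)))
      ≡⟨ cong ((∑[ x ∈ xs ] 𝟙 (P? x)) *_) (∑-𝟙-all-allVecs xs ℓ) ⟩
    (∑[ x ∈ xs ] 𝟙 (P? x)) ^ suc ℓ ∎
    where
    open ≡-Reasoning
    cs : List (Vec A ℓ)
    cs = allVecs xs ℓ

  count-all-allVecs : ∀ xs ℓ → count (λ (c : Vec A ℓ) → all? P? (toList c)) (allVecs xs ℓ) ≡ count P? xs ^ ℓ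
  count-all-allVecs xs ℓ = begin
    count (λ c → all? P? (toList c)) (allVecs xs ℓ)  ≡⟨ count≡∑𝟙 (λ c → all? P? (toList c)) (allVecs xs ℓ) ⟩
    ∑[ c ∈ allVecs xs ℓ ] 𝟙 (all? P? (toList c))   ≡⟨ ∑-𝟙-all-allVecs xs ℓ ⟩
    (∑[ x ∈ xs ] 𝟙 (P? x)) ^ ℓ                      ≡⟨ cong (_^ ℓ) (count≡∑𝟙 P? xs) ⟨
    count P? xs ^ ℓ                                 ∎
    where open ≡-Reasoning

length-allVecs : ∀ (xs : List A) ℓ → length (allVecs xs ℓ) ≡ length xs ^ ℓ
length-allVecs xs ℓ = begin
  length (allVecs xs ℓ)                     ≡⟨ count-universal all⊤? (λ c → All.universal (λ _ → tt) (toList c)) (allVecs xs ℓ) ⟨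
  count all⊤? (allVecs xs ℓ)                ≡⟨ count-all-allVecs ⊤? xs ℓ ⟩
  count ⊤? xs ^ ℓ                           ≡⟨ cong (_^ ℓ) (count-universal ⊤? _ xs) ⟩
  length xs ^ ℓ                             ∎
  where
  open ≡-Reasoning
  ⊤? : Decidable {A = A} (λ _ → ⊤)
  ⊤? _ = yes tt
  all⊤? : Decidable {A = Vec A ℓ} (λ c → All (λ _ → ⊤) (toList c))
  all⊤? c = all? ⊤? (toList c)

length-Ω : ∀ k ℓ → length (Ω k ℓ) ≡ k ^ ℓ
length-Ω k ℓ = trans (length-allVecs (allFin k) ℓ) (cong (_^ ℓ) (length-allFin k))

product≢0⇔All≢0 : ∀ ns → (product ns ≢ 0) ⇔ All (_≢ 0) ns
product≢0⇔All≢0 ns = mk⇔ (product≢0⇒All≢0 ns) (All≢0⇒product≢0 ns)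
  where
  product≢0⇒All≢0 : ∀ ns → product ns ≢ 0 → All (_≢ 0) ns
  product≢0⇒All≢0 [] _ = All.[]
  product≢0⇒All≢0 (n ∷ ns) ≢0 =
    (λ n≡0 → ≢0 (cong (_* product ns) n≡0)) All.∷
    product≢0⇒All≢0 ns (λ ∏≡0 → ≢0 (trans (cong (n *_) ∏≡0) (*-zeroʳ n)))
  All≢0⇒product≢0 : ∀ ns → All (_≢ 0) ns → product ns ≢ 0
  All≢0⇒product≢0 (n ∷ ns) (n≢0 All.∷ ns≢0) =
    [ n≢0 , All≢0⇒product≢0 ns ns≢0 ]′ ∘ m*n≡0⇒m≡0∨n≡0 n

module _ {k ℓ D} {U : Set} (h : Family k U (ℓ * D)) (c : Vec (Fin k) ℓ) (ab : U) where

  private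
    values : List ℕ
    values = toList (Vec.map (λ i → toℕ (h i ab)) c)

  iteratedH≡0⇔product≡0 : (iteratedH h c ab ≡ 0) ⇔ (product values ≡ 0)
  iteratedH≡0⇔product≡0 with product values
  ... | zero = mk⇔ (λ _ → refl) (λ _ → refl)
  ... | suc _ = mk⇔ (λ ()) (λ ())

  iteratedH≢0⇔ : (iteratedH h c ab ≢ 0) ⇔ All (λ i → toℕ (h i ab) ≢ 0) (toList c)
  iteratedH≢0⇔ = mk⇔
    (λ H≢0 → map⁻ (subst (All (_≢ 0)) (toList-map _ c)
      (to (product≢0⇔All≢0 values) (H≢0 ∘ from iteratedH≡0⇔product≡0))))
    (λ all≢0 → from (product≢0⇔All≢0 values) (subst (All (_≢ 0)) (sym (toList-map _ c)) (map⁺ all≢0))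
      ∘ to iteratedH≡0⇔product≡0)

^-distribʳ-* : ∀ m n o → (m * n) ^ o ≡ m ^ o * n ^ o
^-distribʳ-* m n zero = refl
^-distribʳ-* m n (suc o) = begin
  m * n * (m * n) ^ o      ≡⟨ cong (m * n *_) (^-distribʳ-* m n o) ⟩
  m * n * (m ^ o * n ^ o)  ≡⟨ [m*n]*[o*p]≡[m*o]*[n*p] m n (m ^ o) (n ^ o) ⟩
  m * m ^ o * (n * n ^ o)  ∎
  where open ≡-Reasoning

x^n*[1+x+n]≤[1+x]^[1+n] : ∀ x n → x ^ n * (suc x + n) ≤ suc x ^ suc n
x^n*[1+x+n]≤[1+x]^[1+n] x zero = ≤-reflexive (begin-equality
  1 * (suc x + 0)  ≡⟨ solve (x ∷ []) ⟩
  suc x * 1        ∎)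
  where open ≤-Reasoning
x^n*[1+x+n]≤[1+x]^[1+n] x (suc n) = begin
  x * x ^ n * (suc x + suc n)      ≡⟨ xy∙z≈y∙xz x (x ^ n) _ ⟩
  x ^ n * (x * (suc x + suc n))    ≤⟨ *-monoʳ-≤ (x ^ n) x[2+x+n]≤[1+x+n][1+x] ⟩
  x ^ n * ((suc x + n) * suc x)    ≡⟨ *-assoc (x ^ n) _ _ ⟨
  x ^ n * (suc x + n) * suc x      ≤⟨ *-monoˡ-≤ (suc x) (x^n*[1+x+n]≤[1+x]^[1+n] x n) ⟩
  suc x ^ suc n * suc x            ≡⟨ *-comm (suc x ^ suc n) (suc x) ⟩
  suc x ^ suc (suc n)              ∎
  where
  open ≤-Reasoning
  x[2+x+n]≤[1+x+n][1+x] : x * (suc x + suc n) ≤ (suc x + n) * suc x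
  x[2+x+n]≤[1+x+n][1+x] = begin
    x * (suc x + suc n)          ≤⟨ m≤m+n _ (suc n) ⟩
    x * (suc x + suc n) + suc n  ≡⟨ solve (x ∷ n ∷ []) ⟩
    (suc x + n) * suc x          ∎

[1+x]^[1+n]≤x^[1+n]+[1+n]*[1+x]^n : ∀ x n → suc x ^ suc n ≤ x ^ suc n + suc n * suc x ^ n
[1+x]^[1+n]≤x^[1+n]+[1+n]*[1+x]^n x zero = ≤-reflexive (begin-equality
  suc x * 1              ≡⟨ solve (x ∷ []) ⟩
  x * 1 + 1 * 1          ∎)
  where open ≤-Reasoning
[1+x]^[1+n]≤x^[1+n]+[1+n]*[1+x]^n x (suc n) = begin
  suc x * suc x ^ suc n
    ≤⟨ *-monoʳ-≤ (suc x) ([1+x]^[1+n]≤x^[1+n]+[1+n]*[1+x]^n x n) ⟩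
  suc x * (x ^ suc n + suc n * suc x ^ n)
    ≡⟨ *-distribˡ-+ (suc x) (x ^ suc n) (suc n * suc x ^ n) ⟩
  suc x * x ^ suc n + suc x * (suc n * suc x ^ n)
    ≡⟨ cong (suc x * x ^ suc n +_) (x∙yz≈y∙xz (suc x) (suc n) (suc x ^ n)) ⟩
  x ^ suc n + x ^ suc (suc n) + suc n * suc x ^ suc n
    ≤⟨ +-monoˡ-≤ _ (+-monoˡ-≤ _ (^-monoˡ-≤ (suc n) (n≤1+n x))) ⟩
  suc x ^ suc n + x ^ suc (suc n) + suc n * suc x ^ suc n
    ≡⟨ cong (_+ suc n * suc x ^ suc n) (+-comm (suc x ^ suc n) _) ⟩
  x ^ suc (suc n) + suc x ^ suc n + suc n * suc x ^ suc n
    ≡⟨ +-assoc (x ^ suc (suc n)) _ _ ⟩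
  x ^ suc (suc n) + suc (suc n) * suc x ^ suc n
    ∎
  where open ≤-Reasoning

4*n≤4+n*n : ∀ n → 4 * n ≤ 4 + n * n
4*n≤4+n*n 0 = z≤n
4*n≤4+n*n 1 = s≤s (s≤s (s≤s (s≤s z≤n)))
4*n≤4+n*n (suc (suc n)) = begin
  4 * (2 + n)              ≤⟨ m≤m+n _ (n * n) ⟩
  4 * (2 + n) + n * n      ≡⟨ solve (n ∷ []) ⟩
  4 + (2 + n) * (2 + n)    ∎
  where open ≤-Reasoning

[1-1/ℓD]^ℓ≤D/[1+D] : ∀ ℓ D x .{{_ : NonZero ℓ}} → suc x ≡ ℓ * D → x ^ ℓ * suc D ≤ D * suc x ^ ℓ
[1-1/ℓD]^ℓ≤D/[1+D] ℓ D x 1+x≡ℓD = *-cancelˡ-≤ ℓ (begin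
  ℓ * (x ^ ℓ * suc D)      ≡⟨ x∙yz≈y∙xz ℓ (x ^ ℓ) (suc D) ⟩
  x ^ ℓ * (ℓ * suc D)      ≡⟨ cong (x ^ ℓ *_) ℓ[1+D]≡1+x+ℓ ⟩
  x ^ ℓ * (suc x + ℓ)      ≤⟨ x^n*[1+x+n]≤[1+x]^[1+n] x ℓ ⟩
  suc x * suc x ^ ℓ        ≡⟨ cong (_* suc x ^ ℓ) 1+x≡ℓD ⟩
  ℓ * D * suc x ^ ℓ        ≡⟨ *-assoc ℓ D (suc x ^ ℓ) ⟩
  ℓ * (D * suc x ^ ℓ)      ∎)
  where
  open ≤-Reasoning
  ℓ[1+D]≡1+x+ℓ : ℓ * suc D ≡ suc x + ℓ
  ℓ[1+D]≡1+x+ℓ = trans (*-suc ℓ D) (trans (+-comm ℓ (ℓ * D)) (cong (_+ ℓ) (sym 1+x≡ℓD)))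

1-1/D≤[1-1/ℓD]^ℓ : ∀ ℓ D x .{{_ : NonZero ℓ}} → suc x ≡ ℓ * D → D * suc x ^ ℓ ≤ D * x ^ ℓ + suc x ^ ℓ
1-1/D≤[1-1/ℓD]^ℓ (suc l) D x 1+x≡ℓD = begin
  D * suc x ^ suc l                               ≤⟨ *-monoʳ-≤ D ([1+x]^[1+n]≤x^[1+n]+[1+n]*[1+x]^n x l) ⟩
  D * (x ^ suc l + suc l * suc x ^ l)             ≡⟨ *-distribˡ-+ D (x ^ suc l) _ ⟩
  D * x ^ suc l + D * (suc l * suc x ^ l)         ≡⟨ cong (D * x ^ suc l +_) D[ℓQ]≡[1+x]Q ⟩
  D * x ^ suc l + suc x ^ suc l                   ∎
  where
  open ≤-Reasoning
  D[ℓQ]≡[1+x]Q : D * (suc l * suc x ^ l) ≡ suc x * suc x ^ l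
  D[ℓQ]≡[1+x]Q = begin-equality
    D * (suc l * suc x ^ l)  ≡⟨ x∙yz≈y∙xz D (suc l) _ ⟩
    suc l * (D * suc x ^ l)  ≡⟨ *-assoc (suc l) D _ ⟨
    suc l * D * suc x ^ l    ≡⟨ cong (_* suc x ^ l) 1+x≡ℓD ⟨
    suc x * suc x ^ l        ∎

complement-ratio-bounds : ∀ A Z T D .{{_ : NonZero D}} → A + Z ≡ T →
  Z * suc D ≤ D * T → D * T ≤ D * Z + T → T ≤ A * (2 * D) × A * D ≤ T
complement-ratio-bounds A Z _ D refl Z[1+D]≤DT DT≤DZ+T = T≤A*2D , AD≤T
  where
  open ≤-Reasoning
  Z≤DA : Z ≤ D * A
  Z≤DA = +-cancelˡ-≤ (D * Z) Z (D * A) (begin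
    D * Z + Z        ≡⟨ solve (D ∷ Z ∷ []) ⟩
    Z * suc D        ≤⟨ Z[1+D]≤DT ⟩
    D * (A + Z)      ≡⟨ solve (A ∷ Z ∷ D ∷ []) ⟩
    D * Z + D * A    ∎)
  T≤A*2D : A + Z ≤ A * (2 * D)
  T≤A*2D = begin
    A + Z            ≤⟨ +-mono-≤ (m≤n*m A D) Z≤DA ⟩
    D * A + D * A    ≡⟨ solve (A ∷ D ∷ []) ⟩
    A * (2 * D)      ∎
  AD≤T : A * D ≤ A + Z
  AD≤T = +-cancelˡ-≤ (D * Z) (A * D) (A + Z) (begin
    D * Z + A * D    ≡⟨ solve (A ∷ Z ∷ D ∷ []) ⟩
    D * (A + Z)      ≤⟨ DT≤DZ+T ⟩
    D * Z + (A + Z)  ∎)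

vanishing-count-bounds : ∀ ℓ D x q A .{{_ : NonZero ℓ}} .{{_ : NonZero D}} → suc x ≡ ℓ * D →
  A + (q * x) ^ ℓ ≡ (q * suc x) ^ ℓ → (q * suc x) ^ ℓ ≤ A * (2 * D) × A * D ≤ (q * suc x) ^ ℓ
vanishing-count-bounds ℓ D x q A 1+x≡ℓD A+Z≡T =
  complement-ratio-bounds A ((q * x) ^ ℓ) ((q * suc x) ^ ℓ) D A+Z≡T Z[1+D]≤DT DT≤DZ+T
  where
  open ≤-Reasoning
  Z[1+D]≤DT : (q * x) ^ ℓ * suc D ≤ D * (q * suc x) ^ ℓ
  Z[1+D]≤DT = begin
    (q * x) ^ ℓ * suc D        ≡⟨ cong (_* suc D) (^-distribʳ-* q x ℓ) ⟩
    q ^ ℓ * x ^ ℓ * suc D      ≡⟨ *-assoc (q ^ ℓ) (x ^ ℓ) (suc D) ⟩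
    q ^ ℓ * (x ^ ℓ * suc D)    ≤⟨ *-monoʳ-≤ (q ^ ℓ) ([1-1/ℓD]^ℓ≤D/[1+D] ℓ D x 1+x≡ℓD) ⟩
    q ^ ℓ * (D * suc x ^ ℓ)    ≡⟨ x∙yz≈y∙xz (q ^ ℓ) D (suc x ^ ℓ) ⟩
    D * (q ^ ℓ * suc x ^ ℓ)    ≡⟨ cong (D *_) (^-distribʳ-* q (suc x) ℓ) ⟨
    D * (q * suc x) ^ ℓ        ∎
  DT≤DZ+T : D * (q * suc x) ^ ℓ ≤ D * (q * x) ^ ℓ + (q * suc x) ^ ℓ
  DT≤DZ+T = begin
    D * (q * suc x) ^ ℓ                      ≡⟨ cong (D *_) (^-distribʳ-* q (suc x) ℓ) ⟩
    D * (q ^ ℓ * suc x ^ ℓ)                  ≡⟨ x∙yz≈y∙xz D (q ^ ℓ) (suc x ^ ℓ) ⟩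
    q ^ ℓ * (D * suc x ^ ℓ)                  ≤⟨ *-monoʳ-≤ (q ^ ℓ) (1-1/D≤[1-1/ℓD]^ℓ ℓ D x 1+x≡ℓD) ⟩
    q ^ ℓ * (D * x ^ ℓ + suc x ^ ℓ)          ≡⟨ *-distribˡ-+ (q ^ ℓ) (D * x ^ ℓ) (suc x ^ ℓ) ⟩
    q ^ ℓ * (D * x ^ ℓ) + q ^ ℓ * suc x ^ ℓ  ≡⟨ cong₂ _+_ (x∙yz≈y∙xz D (q ^ ℓ) (x ^ ℓ)) (^-distribʳ-* q (suc x) ℓ) ⟨
    D * (q ^ ℓ * x ^ ℓ) + (q * suc x) ^ ℓ    ≡⟨ cong (λ z → D * z + (q * suc x) ^ ℓ) (^-distribʳ-* q x ℓ) ⟨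
    D * (q * x) ^ ℓ + (q * suc x) ^ ℓ        ∎

second-moment-zeros : ∀ (X : A → ℕ) {P : Pred A 0ℓ} (P? : Decidable P) → (∀ x → P x → X x ≡ 0) →
  ∀ xs → 4 * ∑ xs X + 4 * count P? xs ≤ 4 * length xs + (∑[ x ∈ xs ] X x * X x)
second-moment-zeros X P? P⇒X≡0 xs = begin
  4 * ∑ xs X + 4 * count P? xs
    ≡⟨ cong₂ _+_ (∑-*ˡ 4 X xs) (trans (∑-*ˡ 4 _ xs) (cong (4 *_) (sym (count≡∑𝟙 P? xs)))) ⟨
  (∑[ x ∈ xs ] 4 * X x) + (∑[ x ∈ xs ] 4 * 𝟙 (P? x))
    ≡⟨ ∑-distrib-+ xs ⟨
  ∑[ x ∈ xs ] (4 * X x + 4 * 𝟙 (P? x))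
    ≤⟨ ∑-mono-≤ 4X+4[X≡0]≤4+X² xs ⟩
  ∑[ x ∈ xs ] (4 + X x * X x)
    ≡⟨ ∑-distrib-+ xs ⟩
  (∑[ x ∈ xs ] 4) + (∑[ x ∈ xs ] X x * X x)
    ≡⟨ cong (_+ (∑[ x ∈ xs ] X x * X x)) (trans (∑-const xs 4) (*-comm (length xs) 4)) ⟩
  4 * length xs + (∑[ x ∈ xs ] X x * X x)
    ∎
  where
  open ≤-Reasoning
  4X+4[X≡0]≤4+X² : ∀ x → 4 * X x + 4 * 𝟙 (P? x) ≤ 4 + X x * X x
  4X+4[X≡0]≤4+X² x with P? x
  ... | yes p rewrite P⇒X≡0 x p = ≤-refl
  ... | no _ = ≤-trans (≤-reflexive (+-identityʳ _)) (4*n≤4+n*n (X x))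

zeros-≤-half : ∀ (X : A → ℕ) {P : Pred A 0ℓ} (P? : Decidable P) → (∀ x → P x → X x ≡ 0) →
  ∀ xs → ∑ xs X ≡ length xs → ∑[ x ∈ xs ] X x * X x ≤ 2 * length xs → count P? xs * 2 ≤ length xs
zeros-≤-half X P? P⇒X≡0 xs ∑X≡n ∑X²≤2n = begin
  count P? xs * 2       ≡⟨ *-comm (count P? xs) 2 ⟩
  2 * count P? xs       ≤⟨ *-cancelˡ-≤ 2 (+-cancelˡ-≤ (4 * n) _ _ 4n+4W≤4n+2n) ⟩
  n                     ∎
  where
  open ≤-Reasoning
  n : ℕ
  n = length xs
  4n+4W≤4n+2n : 4 * n + 2 * (2 * count P? xs) ≤ 4 * n + 2 * n
  4n+4W≤4n+2n = begin
    4 * n + 2 * (2 * count P? xs)      ≡⟨ cong₂ (λ s w → 4 * s + w) ∑X≡n (*-assoc 2 2 (count P? xs)) ⟨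
    4 * ∑ xs X + 4 * count P? xs       ≤⟨ second-moment-zeros X P? P⇒X≡0 xs ⟩
    4 * n + (∑[ x ∈ xs ] X x * X x)    ≤⟨ +-monoʳ-≤ (4 * n) ∑X²≤2n ⟩
    4 * n + 2 * n                      ∎

module PairwiseIndependence {k m} {U : Set} (h : Family k U m) (indep : PairwiseIndependent h) where

  hits : U → Fin m → ℕ
  hits u v = count (λ i → h i u ≟ᶠ v) (allFin k)

  jointHits : U → Fin m → U → Fin m → ℕ
  jointHits u v u' v' = count (λ i → (h i u ≟ᶠ v) ×-dec (h i u' ≟ᶠ v')) (allFin k)

  jointHits≡∑ : ∀ u v u' v' → jointHits u v u' v' ≡ ∑[ i ∈ allFin k ] 𝟙 (h i u ≟ᶠ v) * 𝟙 (h i u' ≟ᶠ v')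
  jointHits≡∑ u v u' v' = trans (count≡∑𝟙 _ (allFin k)) (∑-cong (λ i → 𝟙-×-dec (h i u ≟ᶠ v) (h i u' ≟ᶠ v')) (allFin k))

  jointHits-diagonal : ∀ u v → jointHits u v u v ≡ hits u v
  jointHits-diagonal u v = begin
    jointHits u v u v                                  ≡⟨ jointHits≡∑ u v u v ⟩
    ∑[ i ∈ allFin k ] 𝟙 (h i u ≟ᶠ v) * 𝟙 (h i u ≟ᶠ v)  ≡⟨ ∑-cong (λ i → 𝟙-idem (h i u ≟ᶠ v)) (allFin k) ⟩
    ∑[ i ∈ allFin k ] 𝟙 (h i u ≟ᶠ v)                   ≡⟨ count≡∑𝟙 _ (allFin k) ⟨
    hits u v                                           ∎
    where open ≡-Reasoning

  ∑-jointHits : ∀ u v u' → ∑[ v' ∈ allFin m ] jointHits u v u' v' ≡ hits u v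
  ∑-jointHits u v u' = begin
    ∑[ v' ∈ allFin m ] jointHits u v u' v'
      ≡⟨ ∑-cong (jointHits≡∑ u v u') (allFin m) ⟩
    ∑[ v' ∈ allFin m ] (∑[ i ∈ allFin k ] 𝟙 (h i u ≟ᶠ v) * 𝟙 (h i u' ≟ᶠ v'))
      ≡⟨ ∑-comm (λ i v' → 𝟙 (h i u ≟ᶠ v) * 𝟙 (h i u' ≟ᶠ v')) (allFin k) (allFin m) ⟨
    ∑[ i ∈ allFin k ] (∑[ v' ∈ allFin m ] 𝟙 (h i u ≟ᶠ v) * 𝟙 (h i u' ≟ᶠ v'))
      ≡⟨ ∑-cong (λ i → ∑-*ˡ (𝟙 (h i u ≟ᶠ v)) _ (allFin m)) (allFin k) ⟩
    ∑[ i ∈ allFin k ] 𝟙 (h i u ≟ᶠ v) * (∑[ v' ∈ allFin m ] 𝟙 (h i u' ≟ᶠ v'))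
      ≡⟨ ∑-cong (λ i → trans (cong (𝟙 (h i u ≟ᶠ v) *_) (∑-𝟙≟-allFin (h i u'))) (*-identityʳ _)) (allFin k) ⟩
    ∑[ i ∈ allFin k ] 𝟙 (h i u ≟ᶠ v)
      ≡⟨ count≡∑𝟙 _ (allFin k) ⟨
    hits u v
      ∎
    where open ≡-Reasoning

  hits-uniform : ∀ {u u'} → u ≢ u' → ∀ v → hits u v * m ≡ k
  hits-uniform {u} {u'} u≢u' v = *-cancelʳ-≡ (hits u v * m) k m {{nonZeroIndex v}} (begin
    hits u v * m * m                                    ≡⟨ *-assoc (hits u v) m m ⟩
    hits u v * (m * m)                                  ≡⟨ cong (_* (m * m)) (∑-jointHits u v u') ⟨
    (∑[ v' ∈ allFin m ] jointHits u v u' v') * (m * m)  ≡⟨ ∑-*ʳ (m * m) _ (allFin m) ⟨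
    ∑[ v' ∈ allFin m ] jointHits u v u' v' * (m * m)    ≡⟨ ∑-cong (indep u u' u≢u' v) (allFin m) ⟩
    ∑[ v' ∈ allFin m ] k                                ≡⟨ ∑-const (allFin m) k ⟩
    length (allFin m) * k                               ≡⟨ cong (_* k) (length-allFin m) ⟩
    m * k                                               ≡⟨ *-comm m k ⟩
    k * m                                               ∎)
    where open ≡-Reasoning

module IteratedPairwiseIndependent
  (l d : ℕ) {k : ℕ} {U : Set} (_≟ᵤ_ : DecidableEquality U) (other : (u : U) → ∃[ u' ] u ≢ u')
  (h : Family k U (suc l * suc d)) (indep : PairwiseIndependent h) where

  open PairwiseIndependence h indep

  private
    ℓ D m x : ℕ
    ℓ = suc l
    D = suc d
    m = ℓ * D
    -- m reduces to suc x, so x plays the role of m − 1 without truncated subtraction.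
    x = d + l * suc d

  zeros : U → ℕ
  zeros u = hits u Fin.zero

  zeros-uniform : ∀ u → zeros u * m ≡ k
  zeros-uniform u = hits-uniform (proj₂ (other u)) Fin.zero

  nonzero? : (u : U) → Decidable (λ i → toℕ (h i u) ≢ 0)
  nonzero? u i = ¬? (toℕ (h i u) ≟ 0)

  nonzeros≡zeros*x : ∀ u → count (nonzero? u) (allFin k) ≡ zeros u * x
  nonzeros≡zeros*x u = +-cancelˡ-≡ (zeros u) _ _ (begin
    zeros u + count (nonzero? u) (allFin k)  ≡⟨ count-complement _ (nonzero? u) ≢zero⇔toℕ≢0 (allFin k) ⟩
    length (allFin k)                        ≡⟨ length-allFin k ⟩
    k                                        ≡⟨ zeros-uniform u ⟨
    zeros u * suc x                          ≡⟨ *-suc (zeros u) x ⟩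
    zeros u + zeros u * x                    ∎)
    where
    open ≡-Reasoning
    ≢zero⇔toℕ≢0 : ∀ i → (h i u ≢ Fin.zero) ⇔ (toℕ (h i u) ≢ 0)
    ≢zero⇔toℕ≢0 i = mk⇔ (λ ≢zero → ≢zero ∘ toℕ-injective) (λ ≢0 → ≢0 ∘ cong toℕ)

  vanishing-count : ∀ ab →
    count (λ c → iteratedH h c ab ≟ 0) (Ω k ℓ) + (zeros ab * x) ^ ℓ ≡ (zeros ab * m) ^ ℓ
  vanishing-count ab = begin
    count vanishes? (Ω k ℓ) + (zeros ab * x) ^ ℓ
      ≡⟨ cong (λ n → count vanishes? (Ω k ℓ) + n ^ ℓ) (nonzeros≡zeros*x ab) ⟨
    count vanishes? (Ω k ℓ) + count (nonzero? ab) (allFin k) ^ ℓ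
      ≡⟨ cong (count vanishes? (Ω k ℓ) +_) (count-all-allVecs (nonzero? ab) (allFin k) ℓ) ⟨
    count vanishes? (Ω k ℓ) + count (λ c → all? (nonzero? ab) (toList c)) (Ω k ℓ)
      ≡⟨ count-complement vanishes? _ (λ c → iteratedH≢0⇔ h c ab) (Ω k ℓ) ⟩
    length (Ω k ℓ)
      ≡⟨ length-Ω k ℓ ⟩
    k ^ ℓ
      ≡⟨ cong (_^ ℓ) (zeros-uniform ab) ⟨
    (zeros ab * m) ^ ℓ
      ∎
    where
    open ≡-Reasoning
    vanishes? : Decidable (λ c → iteratedH h c ab ≡ 0)
    vanishes? c = iteratedH h c ab ≟ 0

  vanishing-probability-bounds : ∀ ab →
      length (Ω k ℓ) ≤ count (λ c → iteratedH h c ab ≟ 0) (Ω k ℓ) * (2 * D)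
    × count (λ c → iteratedH h c ab ≟ 0) (Ω k ℓ) * D ≤ length (Ω k ℓ)
  vanishing-probability-bounds ab =
    subst (λ n → n ≤ vanishing * (2 * D) × vanishing * D ≤ n) |Ω|≡T
      (vanishing-count-bounds ℓ D x (zeros ab) vanishing refl (vanishing-count ab))
    where
    vanishing : ℕ
    vanishing = count (λ c → iteratedH h c ab ≟ 0) (Ω k ℓ)
    |Ω|≡T : (zeros ab * m) ^ ℓ ≡ length (Ω k ℓ)
    |Ω|≡T = trans (cong (_^ ℓ) (zeros-uniform ab)) (sym (length-Ω k ℓ))

  zerosOn : List U → Fin k → ℕ
  zerosOn S i = count (λ u → h i u ≟ᶠ Fin.zero) S

  jointZeros : U → U → ℕ
  jointZeros u u' = jointHits u Fin.zero u' Fin.zero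

  ∑-zerosOn : ∀ S → ∑[ i ∈ allFin k ] zerosOn S i ≡ ∑[ u ∈ S ] zeros u
  ∑-zerosOn S = begin
    ∑[ i ∈ allFin k ] zerosOn S i                     ≡⟨ ∑-cong (λ i → count≡∑𝟙 _ S) (allFin k) ⟩
    ∑[ i ∈ allFin k ] (∑[ u ∈ S ] 𝟙 (h i u ≟ᶠ Fin.zero)) ≡⟨ ∑-comm (λ i u → 𝟙 (h i u ≟ᶠ Fin.zero)) (allFin k) S ⟩
    ∑[ u ∈ S ] (∑[ i ∈ allFin k ] 𝟙 (h i u ≟ᶠ Fin.zero)) ≡⟨ ∑-cong (λ u → count≡∑𝟙 _ (allFin k)) S ⟨
    ∑[ u ∈ S ] zeros u                                ∎
    where open ≡-Reasoning

  ∑-zerosOn² : ∀ S → ∑[ i ∈ allFin k ] zerosOn S i * zerosOn S i ≡ ∑[ u ∈ S ] ∑[ u' ∈ S ] jointZeros u u'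
  ∑-zerosOn² S = begin
    ∑[ i ∈ allFin k ] zerosOn S i * zerosOn S i
      ≡⟨ ∑-cong (λ i → cong₂ _*_ (count≡∑𝟙 _ S) (count≡∑𝟙 _ S)) (allFin k) ⟩
    ∑[ i ∈ allFin k ] (∑[ u ∈ S ] z i u) * (∑[ u' ∈ S ] z i u')
      ≡⟨ ∑-cong (λ i → ∑-*ʳ _ (z i) S) (allFin k) ⟨
    ∑[ i ∈ allFin k ] ∑[ u ∈ S ] z i u * (∑[ u' ∈ S ] z i u')
      ≡⟨ ∑-cong (λ i → ∑-cong (λ u → ∑-*ˡ (z i u) (z i) S) S) (allFin k) ⟨
    ∑[ i ∈ allFin k ] ∑[ u ∈ S ] ∑[ u' ∈ S ] z i u * z i u'
      ≡⟨ ∑-comm (λ i u → ∑[ u' ∈ S ] z i u * z i u') (allFin k) S ⟩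
    ∑[ u ∈ S ] ∑[ i ∈ allFin k ] ∑[ u' ∈ S ] z i u * z i u'
      ≡⟨ ∑-cong (λ u → ∑-comm (λ i u' → z i u * z i u') (allFin k) S) S ⟩
    ∑[ u ∈ S ] ∑[ u' ∈ S ] ∑[ i ∈ allFin k ] z i u * z i u'
      ≡⟨ ∑-cong (λ u → ∑-cong (λ u' → jointHits≡∑ u Fin.zero u' Fin.zero) S) S ⟨
    ∑[ u ∈ S ] ∑[ u' ∈ S ] jointZeros u u'
      ∎
    where
    open ≡-Reasoning
    z : Fin k → U → ℕ
    z i u = 𝟙 (h i u ≟ᶠ Fin.zero)

  ∑-zerosOn-uniform : ∀ {S} → length S ≡ m → ∑[ i ∈ allFin k ] zerosOn S i ≡ k
  ∑-zerosOn-uniform {S} |S|≡m = *-cancelʳ-≡ _ k m (begin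
    (∑[ i ∈ allFin k ] zerosOn S i) * m  ≡⟨ cong (_* m) (∑-zerosOn S) ⟩
    (∑[ u ∈ S ] zeros u) * m             ≡⟨ ∑-*ʳ m zeros S ⟨
    ∑[ u ∈ S ] zeros u * m               ≡⟨ ∑-cong zeros-uniform S ⟩
    ∑[ u ∈ S ] k                         ≡⟨ ∑-const S k ⟩
    length S * k                         ≡⟨ cong (_* k) |S|≡m ⟩
    m * k                                ≡⟨ *-comm m k ⟩
    k * m                                ∎)
    where open ≡-Reasoning

  jointZeros-bound : ∀ u u' → jointZeros u u' * (m * m) ≤ 𝟙 (u ≟ᵤ u') * (k * m) + k
  jointZeros-bound u u' with u ≟ᵤ u'
  ... | no u≢u' = ≤-reflexive (indep u u' u≢u' Fin.zero Fin.zero)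
  ... | yes refl = begin
    jointZeros u u * (m * m)  ≡⟨ cong (_* (m * m)) (jointHits-diagonal u Fin.zero) ⟩
    zeros u * (m * m)         ≡⟨ *-assoc (zeros u) m m ⟨
    zeros u * m * m           ≡⟨ cong (_* m) (zeros-uniform u) ⟩
    k * m                     ≡⟨ *-identityˡ (k * m) ⟨
    1 * (k * m)               ≤⟨ m≤m+n (1 * (k * m)) k ⟩
    1 * (k * m) + k           ∎
    where open ≤-Reasoning

  ∑-jointZeros-row : ∀ {S} → Unique S → length S ≡ m → ∀ u →
    (∑[ u' ∈ S ] jointZeros u u') * (m * m) ≤ 2 * (k * m)
  ∑-jointZeros-row {S} S! |S|≡m u = begin
    (∑[ u' ∈ S ] jointZeros u u') * (m * m)
      ≡⟨ ∑-*ʳ (m * m) (jointZeros u) S ⟨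
    ∑[ u' ∈ S ] jointZeros u u' * (m * m)
      ≤⟨ ∑-mono-≤ (jointZeros-bound u) S ⟩
    ∑[ u' ∈ S ] (𝟙 (u ≟ᵤ u') * (k * m) + k)
      ≡⟨ ∑-distrib-+ S ⟩
    (∑[ u' ∈ S ] 𝟙 (u ≟ᵤ u') * (k * m)) + (∑[ u' ∈ S ] k)
      ≡⟨ cong₂ _+_ (∑-*ʳ (k * m) (λ u' → 𝟙 (u ≟ᵤ u')) S) (trans (∑-const S k) (cong (_* k) |S|≡m)) ⟩
    (∑[ u' ∈ S ] 𝟙 (u ≟ᵤ u')) * (k * m) + m * k
      ≤⟨ +-mono-≤ (*-monoˡ-≤ (k * m) (∑-𝟙≟-unique≤1 _≟ᵤ_ u S!)) (≤-reflexive (*-comm m k)) ⟩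
    1 * (k * m) + k * m
      ≡⟨ +-comm (1 * (k * m)) (k * m) ⟩
    2 * (k * m)
      ∎
    where open ≤-Reasoning

  ∑-zerosOn²-bound : ∀ {S} → Unique S → length S ≡ m → ∑[ i ∈ allFin k ] zerosOn S i * zerosOn S i ≤ 2 * k
  ∑-zerosOn²-bound {S} S! |S|≡m = *-cancelʳ-≤ _ (2 * k) (m * m) (begin
    (∑[ i ∈ allFin k ] zerosOn S i * zerosOn S i) * (m * m)
      ≡⟨ cong (_* (m * m)) (∑-zerosOn² S) ⟩
    (∑[ u ∈ S ] ∑[ u' ∈ S ] jointZeros u u') * (m * m)
      ≡⟨ ∑-*ʳ (m * m) _ S ⟨
    ∑[ u ∈ S ] (∑[ u' ∈ S ] jointZeros u u') * (m * m)
      ≤⟨ ∑-mono-≤ (∑-jointZeros-row S! |S|≡m) S ⟩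
    ∑[ u ∈ S ] 2 * (k * m)
      ≡⟨ trans (∑-const S _) (cong (_* (2 * (k * m))) |S|≡m) ⟩
    m * (2 * (k * m))
      ≡⟨ *-comm m _ ⟩
    2 * (k * m) * m
      ≡⟨ trans (*-assoc 2 (k * m) m) (cong (2 *_) (*-assoc k m m)) ⟩
    2 * (k * (m * m))
      ≡⟨ *-assoc 2 k (m * m) ⟨
    2 * k * (m * m)
      ∎)
    where open ≤-Reasoning

  avoids? : (S : List U) → Decidable (λ i → All (λ u → toℕ (h i u) ≢ 0) S)
  avoids? S i = all? (λ u → nonzero? u i) S

  avoiders-count : ∀ {S} → Unique S → length S ≡ m → count (avoids? S) (allFin k) * 2 ≤ k
  avoiders-count {S} S! |S|≡m = subst (count (avoids? S) (allFin k) * 2 ≤_) (length-allFin k)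
    (zeros-≤-half (zerosOn S) (avoids? S) avoids⇒zerosOn≡0 (allFin k)
      (trans (∑-zerosOn-uniform {S} |S|≡m) (sym (length-allFin k)))
      (subst (λ n → ∑[ i ∈ allFin k ] zerosOn S i * zerosOn S i ≤ 2 * n) (sym (length-allFin k))
        (∑-zerosOn²-bound S! |S|≡m)))
    where
    avoids⇒zerosOn≡0 : ∀ i → All (λ u → toℕ (h i u) ≢ 0) S → zerosOn S i ≡ 0
    avoids⇒zerosOn≡0 i = count-none _ ∘ All.map (λ ≢0 → ≢0 ∘ cong toℕ)

  nonvanishing-probability-bound : ∀ S → Unique S → length S ≡ m →
    count (λ c → all? (λ ab → ¬? (iteratedH h c ab ≟ 0)) S) (Ω k ℓ) * 2 ^ ℓ ≤ length (Ω k ℓ)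
  nonvanishing-probability-bound S S! |S|≡m = begin
    count (λ c → all? (λ ab → ¬? (iteratedH h c ab ≟ 0)) S) (Ω k ℓ) * 2 ^ ℓ
      ≡⟨ cong (_* 2 ^ ℓ) (count-cong _ _ nonvanishing⇔avoiding (Ω k ℓ)) ⟩
    count (λ c → all? (avoids? S) (toList c)) (Ω k ℓ) * 2 ^ ℓ
      ≡⟨ cong (_* 2 ^ ℓ) (count-all-allVecs (avoids? S) (allFin k) ℓ) ⟩
    count (avoids? S) (allFin k) ^ ℓ * 2 ^ ℓ
      ≡⟨ ^-distribʳ-* (count (avoids? S) (allFin k)) 2 ℓ ⟨
    (count (avoids? S) (allFin k) * 2) ^ ℓ
      ≤⟨ ^-monoˡ-≤ ℓ (avoiders-count S! |S|≡m) ⟩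
    k ^ ℓ
      ≡⟨ length-Ω k ℓ ⟨
    length (Ω k ℓ)
      ∎
    where
    open ≤-Reasoning
    nonvanishing⇔avoiding : ∀ c →
      All (λ ab → iteratedH h c ab ≢ 0) S ⇔ All (λ i → All (λ u → toℕ (h i u) ≢ 0) S) (toList c)
    nonvanishing⇔avoiding c = mk⇔
      (All-swap ∘ All.map (to (iteratedH≢0⇔ h c _)))
      (All.map (from (iteratedH≢0⇔ h c _)) ∘ All-swap)

other : ∀ {n} (u : Γ² (suc (suc n))) → ∃[ u' ] u ≢ u'
other (Fin.zero , b) = (Fin.suc Fin.zero , b) , λ ()
other (Fin.suc a , b) = (Fin.zero , b) , λ ()

proposition6 : (D ℓ n k : ℕ) → 1 ≤ D → 1 ≤ ℓ → 2 ≤ n → 1 ≤ k →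
    (h : Family k (Γ² n) (ℓ * D)) → PairwiseIndependent h →
    (∀ (ab : Γ² n) →
        length (Ω k ℓ) ≤ count (λ c → iteratedH h c ab ≟ 0) (Ω k ℓ) * (2 * D)
      × count (λ c → iteratedH h c ab ≟ 0) (Ω k ℓ) * D ≤ length (Ω k ℓ))
    × (∀ (S : List (Γ² n)) → Unique S → length S ≡ ℓ * D →
        count (λ c → all? (λ ab → ¬? (iteratedH h c ab ≟ 0)) S) (Ω k ℓ) * 2 ^ ℓ
          ≤ length (Ω k ℓ))
proposition6 (suc d) (suc l) (suc (suc n)) k (s≤s z≤n) (s≤s z≤n) (s≤s (s≤s z≤n)) _ h indep =
  vanishing-probability-bounds , nonvanishing-probability-bound
  where open IteratedPairwiseIndependent l d (≡-dec _≟ᶠ_ _≟ᶠ_) other h indep
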